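{- Let $\alpha,\beta,r,s$ be complex numbers and let $(a_n)_{n\ge0}$ be the Horadam sequence defined by $a_0=\alpha$, $a_1=\beta$, $a_n=ra_{n-1}+sa_{n-2}$ for $n\ge2$. Define its gap-sum sequence by $$S_n=\frac12\,(a_n+a_{n+1})(a_{n+1}-a_n-1),\qquad n\ge0.$$ Let $$W=\frac{\beta^2+s(\alpha^2 s+2\alpha\beta r-\beta^2)x-\alpha^2 s^3x^2}{1-(r^2+s)x-s(r^2+s)x^2+s^3x^3},\qquad X=\frac{\alpha^2-(\alpha^2(r^2+s)-\beta^2)x-s(\alpha^2r^2-2\alpha\beta r+\beta^2)x^2}{1-(r^2+s)x-s(r^2+s)x^2+s^3x^3},$$ $$Y=\frac{\beta+\alpha s x}{1-rx-sx^2},\qquad Z=\frac{\alpha-(\alpha r-\beta)x}{1-rx-sx^2}.$$ Then, as formal power series, $\displaystyle\sum_{n\ge0}S_nx^n=\frac12\left(W-X-Y-Z\right).$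
   Context: For a strictly increasing integer sequence, $S_n$ equals the sum of the integers strictly between $a_n$ and $a_{n+1}$; here it is defined by the displayed formula for any Horadam sequence. -}

module Defs where

open import Level using (_⊔_)
open import Algebra.Bundles using (CommutativeRing)
open import Data.Nat as ℕ using (ℕ; zero; suc; _∸_)
open import Data.List using (List; []; _∷_)

-- Formal power series over a commutative ring R are coefficient
-- functions ℕ → Carrier; equality of series is coefficientwise ≈.
module PowerSeries {c ℓ} (R : CommutativeRing c ℓ) where
  open CommutativeRing R hiding (zero)

  Series : Set c
  Series = ℕ → Carrier

  sumTo : (ℕ → Carrier) → ℕ → Carrier
  sumTo f zero    = f zero
  sumTo f (suc n) = sumTo f n + f (suc n)

  _⊛_ : Series → Series → Series
  (f ⊛ g) n = sumTo (λ k → f k * g (n ∸ k)) n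

  poly : List Carrier → Series
  poly []       _       = 0#
  poly (c ∷ cs) zero    = c
  poly (c ∷ cs) (suc n) = poly cs n

  -- Multiplicative inverse of a series q with constant term 1
  -- (the value q 0 is not consulted; it is assumed to be 1):
  -- b₀ = 1, bₙ = - Σ_{k=1}^{n} q k * b (n-k).
  -- invList q n = [bₙ, bₙ₋₁, …, b₀].
  private
    dot : (ℕ → Carrier) → List Carrier → Carrier
    dot q []       = 0#
    dot q (b ∷ bs) = q 1 * b + dot (λ k → q (suc k)) bs

  invList : Series → ℕ → List Carrier
  invList q zero    = 1# ∷ []
  invList q (suc n) = (- dot q (invList q n)) ∷ invList q n

  inv : Series → Series
  inv q n with invList q n
  ... | []    = 0#
  ... | b ∷ _ = b

  ratio : List Carrier → List Carrier → Series
  ratio num den = poly num ⊛ inv (poly den)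

  two : Carrier
  two = 1# + 1#

  horadam : (α β r s : Carrier) → ℕ → Carrier
  horadam α β r s zero          = α
  horadam α β r s (suc zero)    = β
  horadam α β r s (suc (suc n)) =
    r * horadam α β r s (suc n) + s * horadam α β r s n

  gapSum : (half α β r s : Carrier) → ℕ → Carrier
  gapSum half α β r s n =
    half * ((a n + a (suc n)) * (a (suc n) - a n - 1#))
    where a = horadam α β r s

  den3 : (r s : Carrier) → List Carrier
  den3 r s = 1# ∷ - (r * r + s) ∷ - (s * (r * r + s)) ∷ s * s * s ∷ []

  den2 : (r s : Carrier) → List Carrier
  den2 r s = 1# ∷ - r ∷ - s ∷ []

  W X Y Z : (α β r s : Carrier) → Series
  W α β r s = ratio
    (β * β ∷ s * (α * α * s + two * α * β * r - β * β) ∷ - (α * α * (s * s * s)) ∷ [])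
    (den3 r s)
  X α β r s = ratio
    (α * α ∷ - (α * α * (r * r + s) - β * β)
           ∷ - (s * (α * α * (r * r) - two * α * β * r + β * β)) ∷ [])
    (den3 r s)
  Y α β r s = ratio (β ∷ α * s ∷ []) (den2 r s)
  Z α β r s = ratio (α ∷ - (α * r - β) ∷ []) (den2 r s)

module Submission where

-- The four rational functions generate a (n+1)², a n², a (n+1) and a n, so the theorem is
-- the coefficientwise identity
-- (a n + a (n+1)) (a (n+1) - a n - 1) = a (n+1)² - a n² - a (n+1) - a n.
-- A sequence T is generated by p / q (q 0 = 1, deg p ≤ 2, deg q ≤ 3) as soon as T satisfies
-- the linear recurrence with characteristic polynomial x³ q (1/x) and p ≡ q T modulo x³:
-- both p / q and T solve that recurrence and they share three initial values. The Horadam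
-- sequence solves the recurrence of 1 - r x - s x², and its squares solve the one of
-- 1 - (r²+s) x - s (r²+s) x² + s³ x³, whose characteristic roots are the squares and the
-- product of those of the former.

open import Defs
open import Algebra.Bundles using (CommutativeRing)
open import Data.Nat using (ℕ)

open import Algebra.Solver.Ring.AlmostCommutativeRing
  using (fromCommutativeRing; _-Raw-AlmostCommutative⟶_)
open import Data.Integer as ℤ using (ℤ; +_; -[1+_]; _⊖_)
import Data.Integer.Properties as ℤ
open import Data.List using ([]; _∷_)
open import Data.Maybe using (Maybe; just; nothing)
open import Data.Nat as ℕ using (zero; suc)
import Data.Nat.Properties as ℕ
open import Data.Product using (Σ; _,_; proj₁)
open import Function using (_∘_)
open import Relation.Binary.PropositionalEquality as ≡ using (_≡_)
open import Relation.Nullary using (yes; no)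

module IntegerCoefficientSolver {c ℓ} (R : CommutativeRing c ℓ) where
  open CommutativeRing R
  open import Algebra.Properties.Ring ring
  open import Algebra.Properties.Semiring.Mult.TCOptimised semiring
    using (_×_; 1+×; ×-homo-+; ×1-homo-*)
  open import Relation.Binary.Reasoning.Setoid setoid

  ι : ℤ → Carrier
  ι (+ n)    = n × 1#
  ι -[1+ n ] = - (suc n × 1#)

  +-cancelˡ-− : ∀ x a b → (x + a) - (x + b) ≈ a - b
  +-cancelˡ-− x a b = begin
    (x + a) + - (x + b)    ≈⟨ +-congˡ (-‿+-comm x b) ⟨
    (x + a) + (- x + - b)  ≈⟨ +-congʳ (+-comm x a) ⟩
    (a + x) + (- x + - b)  ≈⟨ +-assoc a x _ ⟩
    a + (x + (- x + - b))  ≈⟨ +-congˡ (+-assoc x (- x) (- b)) ⟨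
    a + ((x + - x) + - b)  ≈⟨ +-congˡ (+-congʳ (-‿inverseʳ x)) ⟩
    a + (0# + - b)         ≈⟨ +-congˡ (+-identityˡ (- b)) ⟩
    a + - b                ∎

  ι-⊖ : ∀ m n → ι (m ⊖ n) ≈ m × 1# - n × 1#
  ι-⊖ m       zero    = trans (sym (+-identityʳ _)) (+-congˡ (sym -0#≈0#))
  ι-⊖ zero    (suc n) = sym (+-identityˡ _)
  ι-⊖ (suc m) (suc n) rewrite ℤ.[1+m]⊖[1+n]≡m⊖n m n = begin
    ι (m ⊖ n)                          ≈⟨ ι-⊖ m n ⟩
    m × 1# - n × 1#                    ≈⟨ +-cancelˡ-− 1# (m × 1#) (n × 1#) ⟨
    (1# + m × 1#) - (1# + n × 1#)      ≈⟨ +-cong (1+× m 1#) (-‿cong (1+× n 1#)) ⟨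
    suc m × 1# - suc n × 1#            ∎

  ι-+ : ∀ i j → ι (i ℤ.+ j) ≈ ι i + ι j
  ι-+ (+ m)    (+ n)    = ×-homo-+ 1# m n
  ι-+ (+ m)    -[1+ n ] = ι-⊖ m (suc n)
  ι-+ -[1+ m ] (+ n)    = trans (ι-⊖ n (suc m)) (+-comm _ _)
  ι-+ -[1+ m ] -[1+ n ] = begin
    - (suc (suc (m ℕ.+ n)) × 1#)     ≡⟨ ≡.cong (λ k → - (suc k × 1#)) (ℕ.+-suc m n) ⟨
    - ((suc m ℕ.+ suc n) × 1#)       ≈⟨ -‿cong (×-homo-+ 1# (suc m) (suc n)) ⟩
    - (suc m × 1# + suc n × 1#)      ≈⟨ -‿+-comm _ _ ⟨
    - (suc m × 1#) + - (suc n × 1#)  ∎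

  ι-* : ∀ i j → ι (i ℤ.* j) ≈ ι i * ι j
  ι-* (+ zero)     (+ n)        = sym (zeroˡ _)
  ι-* (+ suc m)    (+ zero)     rewrite ℕ.*-zeroʳ m = sym (zeroʳ _)
  ι-* (+ suc m)    (+ suc n)    = ×1-homo-* (suc m) (suc n)
  ι-* (+ zero)     -[1+ n ]     = sym (zeroˡ _)
  ι-* (+ suc m)    -[1+ n ]     =
    trans (-‿cong (×1-homo-* (suc m) (suc n))) (-‿distribʳ-* _ _)
  ι-* -[1+ m ]     (+ zero)     rewrite ℕ.*-zeroʳ m = sym (zeroʳ _)
  ι-* -[1+ m ]     (+ suc n)    =
    trans (-‿cong (×1-homo-* (suc m) (suc n))) (-‿distribˡ-* _ _)
  ι-* -[1+ m ]     -[1+ n ]     = begin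
    (suc m ℕ.* suc n) × 1#               ≈⟨ ×1-homo-* (suc m) (suc n) ⟩
    suc m × 1# * suc n × 1#              ≈⟨ -‿involutive _ ⟨
    - - (suc m × 1# * suc n × 1#)        ≈⟨ -‿cong (-‿distribˡ-* _ _) ⟩
    - (- (suc m × 1#) * suc n × 1#)      ≈⟨ -‿distribʳ-* _ _ ⟩
    - (suc m × 1#) * - (suc n × 1#)      ∎

  ι-neg : ∀ i → ι (ℤ.- i) ≈ - ι i
  ι-neg (+ zero)   = sym -0#≈0#
  ι-neg (+ suc n)  = refl
  ι-neg -[1+ n ]   = sym (-‿involutive _)

  ι-homomorphism : ℤ.+-*-rawRing -Raw-AlmostCommutative⟶ fromCommutativeRing R
  ι-homomorphism = record
    { ⟦_⟧ = ι ; +-homo = ι-+ ; *-homo = ι-* ; -‿homo = ι-neg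
    ; 0-homo = refl ; 1-homo = refl }

  ι-≟ : ∀ i j → Maybe (ι i ≈ ι j)
  ι-≟ i j with i ℤ.≟ j
  ... | yes ≡.refl = just refl
  ... | no _       = nothing

  open import Algebra.Solver.Ring ℤ.+-*-rawRing (fromCommutativeRing R) ι-homomorphism ι-≟
    public

module LinearRecurrences {c ℓ} (R : CommutativeRing c ℓ) where
  open CommutativeRing R hiding (zero)
  open PowerSeries R
  open IntegerCoefficientSolver R using (solve; _:=_; _:+_; _:*_; :-_; con)
  open import Data.Product using (_×_)
  open import Relation.Binary.Reasoning.Setoid setoid

  private variable
    d₁ d₂ d₃ : Carrier
    G S T : Series

  Recurrence : (d₁ d₂ d₃ : Carrier) → Series → Set ℓ
  Recurrence d₁ d₂ d₃ T =
    ∀ n → T (3 ℕ.+ n) ≈ - (d₁ * T (2 ℕ.+ n) + (d₂ * T (1 ℕ.+ n) + d₃ * T n))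

  Recurrence-shift : Recurrence d₁ d₂ d₃ T → Recurrence d₁ d₂ d₃ (T ∘ suc)
  Recurrence-shift rec n = rec (suc n)

  Recurrence-+ : Recurrence d₁ d₂ d₃ S → Recurrence d₁ d₂ d₃ T →
                 Recurrence d₁ d₂ d₃ (λ n → S n + T n)
  Recurrence-+ {d₁} {d₂} {d₃} recS recT n =
    trans (+-cong (recS n) (recT n)) (-combination-+ d₁ d₂ d₃ _ _ _ _ _ _)
    where
    -combination-+ : ∀ d₁ d₂ d₃ x₀ x₁ x₂ y₀ y₁ y₂ →
      - (d₁ * x₂ + (d₂ * x₁ + d₃ * x₀)) + - (d₁ * y₂ + (d₂ * y₁ + d₃ * y₀))
        ≈ - (d₁ * (x₂ + y₂) + (d₂ * (x₁ + y₁) + d₃ * (x₀ + y₀)))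
    -combination-+ = solve 9 (λ d₁ d₂ d₃ x₀ x₁ x₂ y₀ y₁ y₂ →
      :- (d₁ :* x₂ :+ (d₂ :* x₁ :+ d₃ :* x₀)) :+ :- (d₁ :* y₂ :+ (d₂ :* y₁ :+ d₃ :* y₀))
        := :- (d₁ :* (x₂ :+ y₂) :+ (d₂ :* (x₁ :+ y₁) :+ d₃ :* (x₀ :+ y₀)))) refl

  Recurrence-scale : ∀ a → Recurrence d₁ d₂ d₃ T → Recurrence d₁ d₂ d₃ (λ n → a * T n)
  Recurrence-scale {d₁} {d₂} {d₃} a rec n =
    trans (*-congˡ (rec n)) (*-combination d₁ d₂ d₃ a _ _ _)
    where
    *-combination : ∀ d₁ d₂ d₃ a x₀ x₁ x₂ →
      a * - (d₁ * x₂ + (d₂ * x₁ + d₃ * x₀)) ≈ - (d₁ * (a * x₂) + (d₂ * (a * x₁) + d₃ * (a * x₀)))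
    *-combination = solve 7 (λ d₁ d₂ d₃ a x₀ x₁ x₂ →
      a :* :- (d₁ :* x₂ :+ (d₂ :* x₁ :+ d₃ :* x₀))
        := :- (d₁ :* (a :* x₂) :+ (d₂ :* (a :* x₁) :+ d₃ :* (a :* x₀)))) refl

  Recurrence-combination : ∀ c₀ c₁ c₂ → Recurrence d₁ d₂ d₃ G →
    Recurrence d₁ d₂ d₃ (λ n → c₀ * G (2 ℕ.+ n) + c₁ * G (1 ℕ.+ n) + c₂ * G n)
  Recurrence-combination c₀ c₁ c₂ rec =
    Recurrence-+ (Recurrence-+ (Recurrence-scale c₀ (Recurrence-shift (Recurrence-shift rec)))
                               (Recurrence-scale c₁ (Recurrence-shift rec)))
                 (Recurrence-scale c₂ rec)

  Recurrence-unique : Recurrence d₁ d₂ d₃ S → Recurrence d₁ d₂ d₃ T →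
    S 0 ≈ T 0 → S 1 ≈ T 1 → S 2 ≈ T 2 → ∀ n → S n ≈ T n
  Recurrence-unique {d₁} {d₂} {d₃} {S} {T} recS recT e₀ e₁ e₂ n = proj₁ (window n)
    where
    window : ∀ n → S n ≈ T n × S (1 ℕ.+ n) ≈ T (1 ℕ.+ n) × S (2 ℕ.+ n) ≈ T (2 ℕ.+ n)
    window zero    = e₀ , e₁ , e₂
    window (suc n) =
      let e , e′ , e″ = window n in
      e′ , e″ , (begin
        S (3 ℕ.+ n)                                        ≈⟨ recS n ⟩
        - (d₁ * S (2 ℕ.+ n) + (d₂ * S (1 ℕ.+ n) + d₃ * S n))
          ≈⟨ -‿cong (+-cong (*-congˡ e″) (+-cong (*-congˡ e′) (*-congˡ e))) ⟩
        - (d₁ * T (2 ℕ.+ n) + (d₂ * T (1 ℕ.+ n) + d₃ * T n)) ≈⟨ recT n ⟨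
        T (3 ℕ.+ n)                                        ∎)

  x+y*0≈x : ∀ x y → x + y * 0# ≈ x
  x+y*0≈x x y = trans (+-congˡ (zeroʳ y)) (+-identityʳ x)

  mulX² : Series → Series
  mulX² g zero          = 0#
  mulX² g (suc zero)    = 0#
  mulX² g (suc (suc n)) = g n

  sumTo-degree≤2 : ∀ f k → (∀ j → f (3 ℕ.+ j) ≈ 0#) → sumTo f (2 ℕ.+ k) ≈ f 0 + f 1 + f 2
  sumTo-degree≤2 f zero    vanish = refl
  sumTo-degree≤2 f (suc k) vanish =
    trans (+-cong (sumTo-degree≤2 f k vanish) (vanish k)) (+-identityʳ _)

  ⊛-degree≤2 : ∀ p g → (∀ j → p (3 ℕ.+ j) ≈ 0#) → ∀ n →
    (p ⊛ g) n ≈ p 0 * mulX² g (2 ℕ.+ n) + p 1 * mulX² g (1 ℕ.+ n) + p 2 * mulX² g n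
  ⊛-degree≤2 p g vanish zero          = sym (trans (x+y*0≈x _ _) (x+y*0≈x _ _))
  ⊛-degree≤2 p g vanish (suc zero)    = sym (x+y*0≈x _ _)
  ⊛-degree≤2 p g vanish (suc (suc k)) =
    sumTo-degree≤2 _ k (λ j → trans (*-congʳ (vanish j)) (zeroˡ _))

  -- Multiplying by x² extends inv q by inv q (-1) = inv q (-2) = 0, and then the defining
  -- equations of inv q 1 and inv q 2 are instances of the recurrence.
  mulX²-inv-recurrence : ∀ q →
    (∀ n → inv q (3 ℕ.+ n) ≈ - (q 1 * inv q (2 ℕ.+ n) + (q 2 * inv q (1 ℕ.+ n) + q 3 * inv q n))) →
    Recurrence (q 1) (q 2) (q 3) (mulX² (inv q))
  mulX²-inv-recurrence q rec zero          =
    -‿cong (+-congˡ (sym (trans (+-cong (zeroʳ _) (zeroʳ _)) (+-identityʳ 0#))))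
  mulX²-inv-recurrence q rec (suc zero)    = -‿cong (+-congˡ (+-congˡ (sym (zeroʳ _))))
  mulX²-inv-recurrence q rec (suc (suc n)) = rec n

  ⊛-inv-solution : ∀ {p q T} →
    Recurrence (q 1) (q 2) (q 3) (mulX² (inv q)) → (∀ j → p (3 ℕ.+ j) ≈ 0#) →
    Recurrence (q 1) (q 2) (q 3) T →
    p 0 ≈ T 0 → p 1 ≈ T 1 + q 1 * T 0 → p 2 ≈ T 2 + (q 1 * T 1 + q 2 * T 0) →
    ∀ n → (p ⊛ inv q) n ≈ T n
  ⊛-inv-solution {p} {q} {T} recInv vanish recT e₀ e₁ e₂ n =
    trans (⊛-degree≤2 p (inv q) vanish n)
          (Recurrence-unique (Recurrence-combination (p 0) (p 1) (p 2) recInv) recT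
                             initial₀ initial₁ initial₂ n)
    where
    initial₀ : p 0 * 1# + p 1 * 0# + p 2 * 0# ≈ T 0
    initial₀ = trans (x+y*0≈x _ _) (trans (x+y*0≈x _ _) (trans (*-identityʳ _) e₀))

    initial₁ : p 0 * inv q 1 + p 1 * 1# + p 2 * 0# ≈ T 1
    initial₁ = trans (x+y*0≈x _ _)
      (trans (+-cong (*-congʳ e₀) (*-congʳ e₁)) (identity₁ (T 0) (T 1) (q 1)))
      where
      identity₁ : ∀ t₀ t₁ d₁ → t₀ * - (d₁ * 1# + 0#) + (t₁ + d₁ * t₀) * 1# ≈ t₁
      identity₁ = solve 3 (λ t₀ t₁ d₁ →
        t₀ :* :- (d₁ :* con (+ 1) :+ con (+ 0)) :+ (t₁ :+ d₁ :* t₀) :* con (+ 1) := t₁) refl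

    initial₂ : p 0 * inv q 2 + p 1 * inv q 1 + p 2 * 1# ≈ T 2
    initial₂ = trans (+-cong (+-cong (*-congʳ e₀) (*-congʳ e₁)) (*-congʳ e₂))
                     (identity₂ (T 0) (T 1) (T 2) (q 1) (q 2))
      where
      identity₂ : ∀ t₀ t₁ t₂ d₁ d₂ →
        let b₁ = - (d₁ * 1# + 0#) in
        t₀ * - (d₁ * b₁ + (d₂ * 1# + 0#)) + (t₁ + d₁ * t₀) * b₁ + (t₂ + (d₁ * t₁ + d₂ * t₀)) * 1#
          ≈ t₂
      identity₂ = solve 5 (λ t₀ t₁ t₂ d₁ d₂ →
        let b₁ = :- (d₁ :* con (+ 1) :+ con (+ 0)) in
        t₀ :* :- (d₁ :* b₁ :+ (d₂ :* con (+ 1) :+ con (+ 0))) :+ (t₁ :+ d₁ :* t₀) :* b₁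
          :+ (t₂ :+ (d₁ :* t₁ :+ d₂ :* t₀)) :* con (+ 1) := t₂) refl

  0*x+t≈0 : ∀ x {t} → t ≈ 0# → 0# * x + t ≈ 0#
  0*x+t≈0 x t≈0 = trans (+-cong (zeroˡ x) t≈0) (+-identityʳ 0#)

  -- In inv q (n+1) = - Σ_{k=1}^{n+1} q k * inv q (n+1-k) the terms with k > deg q are
  -- 0# * inv q j, but this sum is the private `dot` of Defs, stuck on n. `zeroTail m` is the
  -- run of such terms ending at inv q 0; it can only be named by unification.
  module CubicInverse (d₁ d₂ d₃ : Carrier) where
    b : Series
    b = inv (poly (1# ∷ d₁ ∷ d₂ ∷ d₃ ∷ []))

    private
      unfold : ∀ m → Σ Carrier λ t → b (5 ℕ.+ m) ≡
        - (d₁ * b (4 ℕ.+ m) + (d₂ * b (3 ℕ.+ m) + (d₃ * b (2 ℕ.+ m) + (0# * b (1 ℕ.+ m) + t))))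
      unfold m = _ , ≡.refl

      zeroTail : ℕ → Carrier
      zeroTail m = proj₁ (unfold m)

      zeroTail≈0 : ∀ m → zeroTail m ≈ 0#
      zeroTail≈0 zero    = 0*x+t≈0 1# refl
      zeroTail≈0 (suc m) = 0*x+t≈0 (b (suc m)) (zeroTail≈0 m)

    recurrence : ∀ n → b (3 ℕ.+ n) ≈ - (d₁ * b (2 ℕ.+ n) + (d₂ * b (1 ℕ.+ n) + d₃ * b n))
    recurrence zero          = -‿cong (+-congˡ (+-congˡ (+-identityʳ _)))
    recurrence (suc zero)    =
      -‿cong (+-congˡ (+-congˡ (trans (+-congˡ (zeroTail≈0 0)) (+-identityʳ _))))
    recurrence (suc (suc m)) =
      -‿cong (+-congˡ (+-congˡ (trans (+-congˡ (zeroTail≈0 (suc m))) (+-identityʳ _))))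

  module QuadraticInverse (d₁ d₂ : Carrier) where
    b : Series
    b = inv (poly (1# ∷ d₁ ∷ d₂ ∷ []))

    private
      unfold : ∀ m → Σ Carrier λ t → b (4 ℕ.+ m) ≡
        - (d₁ * b (3 ℕ.+ m) + (d₂ * b (2 ℕ.+ m) + (0# * b (1 ℕ.+ m) + t)))
      unfold m = _ , ≡.refl

      zeroTail : ℕ → Carrier
      zeroTail m = proj₁ (unfold m)

      zeroTail≈0 : ∀ m → zeroTail m ≈ 0#
      zeroTail≈0 zero    = 0*x+t≈0 1# refl
      zeroTail≈0 (suc m) = 0*x+t≈0 (b (suc m)) (zeroTail≈0 m)

    recurrence : ∀ n → b (3 ℕ.+ n) ≈ - (d₁ * b (2 ℕ.+ n) + (d₂ * b (1 ℕ.+ n) + 0# * b n))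
    recurrence zero    = -‿cong (+-congˡ (+-congˡ (+-identityʳ _)))
    recurrence (suc m) = -‿cong (+-congˡ (+-congˡ (trans (+-congˡ (zeroTail≈0 m)) (+-identityʳ _))))

module HoradamGeneratingFunctions {c ℓ} (R : CommutativeRing c ℓ) where
  open CommutativeRing R hiding (zero)
  open PowerSeries R
  open LinearRecurrences R
  open IntegerCoefficientSolver R using (solve; _:=_; _:+_; _:*_; _:-_; :-_; con)
  open import Relation.Binary.Reasoning.Setoid setoid

  r*z+s*y≈-[-r*z+[-s*y+0*x]] : ∀ r s x y z → r * z + s * y ≈ - (- r * z + (- s * y + 0# * x))
  r*z+s*y≈-[-r*z+[-s*y+0*x]] = solve 5 (λ r s x y z →
    r :* z :+ s :* y := :- (:- r :* z :+ (:- s :* y :+ con (+ 0) :* x))) refl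

  square-recurrence : ∀ r s x y →
    let z = r * y + s * x in
    (r * z + s * y) * (r * z + s * y)
      ≈ - (- (r * r + s) * (z * z) + (- (s * (r * r + s)) * (y * y) + s * s * s * (x * x)))
  square-recurrence = solve 4 (λ r s x y →
    let z = r :* y :+ s :* x in
    (r :* z :+ s :* y) :* (r :* z :+ s :* y)
      := :- (:- (r :* r :+ s) :* (z :* z)
             :+ (:- (s :* (r :* r :+ s)) :* (y :* y) :+ s :* s :* s :* (x :* x)))) refl

  [x+y][y-x-1]≈yy-xx-y-x : ∀ x y → (x + y) * (y - x - 1#) ≈ y * y - x * x - y - x
  [x+y][y-x-1]≈yy-xx-y-x = solve 2 (λ x y →
    (x :+ y) :* (y :- x :- con (+ 1)) := y :* y :- x :* x :- y :- x) refl

  module _ (α β r s : Carrier) where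
    private
      a : Series
      a = horadam α β r s

    horadam-recurrence : Recurrence (- r) (- s) 0# a
    horadam-recurrence n = r*z+s*y≈-[-r*z+[-s*y+0*x]] r s (a n) (a (1 ℕ.+ n)) (a (2 ℕ.+ n))

    horadam²-recurrence : Recurrence (- (r * r + s)) (- (s * (r * r + s))) (s * s * s)
                                     (λ n → a n * a n)
    horadam²-recurrence n = square-recurrence r s (a n) (a (1 ℕ.+ n))

    cubic-inverse : Recurrence (- (r * r + s)) (- (s * (r * r + s))) (s * s * s)
                               (mulX² (inv (poly (den3 r s))))
    cubic-inverse = mulX²-inv-recurrence _ (CubicInverse.recurrence _ _ _)

    quadratic-inverse : Recurrence (- r) (- s) 0# (mulX² (inv (poly (den2 r s))))
    quadratic-inverse = mulX²-inv-recurrence _ (QuadraticInverse.recurrence _ _)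

    W≈a[n+1]² : ∀ n → W α β r s n ≈ a (1 ℕ.+ n) * a (1 ℕ.+ n)
    W≈a[n+1]² = ⊛-inv-solution cubic-inverse (λ _ → refl)
      (Recurrence-shift horadam²-recurrence) refl
      (solve 4 (λ α β r s → let a₂ = r :* β :+ s :* α in
         s :* (α :* α :* s :+ con (+ 2) :* α :* β :* r :- β :* β)
           := a₂ :* a₂ :+ :- (r :* r :+ s) :* (β :* β)) refl α β r s)
      (solve 4 (λ α β r s → let a₂ = r :* β :+ s :* α ; a₃ = r :* a₂ :+ s :* β in
         :- (α :* α :* (s :* s :* s))
           := a₃ :* a₃ :+ (:- (r :* r :+ s) :* (a₂ :* a₂) :+ :- (s :* (r :* r :+ s)) :* (β :* β)))
         refl α β r s)

    X≈a[n]² : ∀ n → X α β r s n ≈ a n * a n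
    X≈a[n]² = ⊛-inv-solution cubic-inverse (λ _ → refl) horadam²-recurrence refl
      (solve 4 (λ α β r s →
         :- (α :* α :* (r :* r :+ s) :- β :* β) := β :* β :+ :- (r :* r :+ s) :* (α :* α))
         refl α β r s)
      (solve 4 (λ α β r s → let a₂ = r :* β :+ s :* α in
         :- (s :* (α :* α :* (r :* r) :- con (+ 2) :* α :* β :* r :+ β :* β))
           := a₂ :* a₂ :+ (:- (r :* r :+ s) :* (β :* β) :+ :- (s :* (r :* r :+ s)) :* (α :* α)))
         refl α β r s)

    Y≈a[n+1] : ∀ n → Y α β r s n ≈ a (1 ℕ.+ n)
    Y≈a[n+1] = ⊛-inv-solution quadratic-inverse (λ _ → refl)
      (Recurrence-shift horadam-recurrence) refl
      (solve 4 (λ α β r s → α :* s := (r :* β :+ s :* α) :+ :- r :* β) refl α β r s)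
      (solve 4 (λ α β r s → let a₂ = r :* β :+ s :* α in
         con (+ 0) := (r :* a₂ :+ s :* β) :+ (:- r :* a₂ :+ :- s :* β)) refl α β r s)

    Z≈a[n] : ∀ n → Z α β r s n ≈ a n
    Z≈a[n] = ⊛-inv-solution quadratic-inverse (λ _ → refl) horadam-recurrence refl
      (solve 4 (λ α β r s → :- (α :* r :- β) := β :+ :- r :* α) refl α β r s)
      (solve 4 (λ α β r s →
         con (+ 0) := (r :* β :+ s :* α) :+ (:- r :* β :+ :- s :* α)) refl α β r s)

    gapSum≈½[W-X-Y-Z] : ∀ half n →
      gapSum half α β r s n ≈ half * (W α β r s n - X α β r s n - Y α β r s n - Z α β r s n)
    gapSum≈½[W-X-Y-Z] half n = *-congˡ (begin
      (a n + a (1 ℕ.+ n)) * (a (1 ℕ.+ n) - a n - 1#)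
        ≈⟨ [x+y][y-x-1]≈yy-xx-y-x (a n) (a (1 ℕ.+ n)) ⟩
      a (1 ℕ.+ n) * a (1 ℕ.+ n) - a n * a n - a (1 ℕ.+ n) - a n
        ≈⟨ +-cong (+-cong (+-cong (W≈a[n+1]² n) (-‿cong (X≈a[n]² n))) (-‿cong (Y≈a[n+1] n)))
                  (-‿cong (Z≈a[n] n)) ⟨
      W α β r s n - X α β r s n - Y α β r s n - Z α β r s n ∎)

mainTheorem5 : ∀ {c ℓ} (R : CommutativeRing c ℓ) →
    let open CommutativeRing R
        open PowerSeries R
    in (half : Carrier) → half * two ≈ 1# →
       (α β r s : Carrier) → (n : ℕ) →
       gapSum half α β r s n
         ≈ half * (W α β r s n - X α β r s n - Y α β r s n - Z α β r s n)
mainTheorem5 R half _ α β r s n = HoradamGeneratingFunctions.gapSum≈½[W-X-Y-Z] R α β r s half n
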